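{- For all positive integers $t$ and $n$, $$S_t(n) < \sqrt{tn} + (tn)^{1/4} + \frac{1}{2},$$ where $S_t(n)$ denotes the maximum cardinality of a $t$-thin Sidon set contained in $\{1,2,\dots,n\}$.
   Context: For a positive integer $t$, a set of integers $A$ is a $t$-thin Sidon set if $|A \cap (A+c)| \leq t$ for every integer $c \neq 0$, where $A+c=\{a+c: a\in A\}$; equivalently, for every $c\neq 0$ the equation $a_i - a_j = c$ has at most $t$ solutions with $a_i,a_j\in A$. (For $t=1$ these are exactly the Sidon sets.) $S_t(n) := \max\{|A| : A\subseteq\{1,\dots,n\},\ A \text{ is } t\text{ -thin}\}$. -}

module Defs where

open import Data.Nat as ℕ using (ℕ; _≤_; _*_)
open import Data.Integer as ℤ using (ℤ; +_)
open import Data.Rational as ℚ using (ℚ; _/_; ½; 0ℚ)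
open import Data.List using (List; length; filter; map)
open import Data.List.Relation.Unary.Any using (any?)
open import Data.List.Relation.Unary.All using (All)
open import Data.List.Relation.Unary.Unique.Propositional using (Unique)
open import Data.List.Membership.Propositional using (_∈_)
open import Data.Product using (Σ; _×_; ∃-syntax)
open import Relation.Binary.PropositionalEquality using (_≡_; _≢_)
open import Relation.Nullary using (¬_; Dec)
open import Data.List.Relation.Unary.Any using (Any)

-- A finite set of integers, represented as a duplicate-free list of naturals
-- (all our sets live inside {1,…,n}).

_∈ℤ?_ : (x : ℤ) (A : List ℕ) → Dec (Any (λ a → x ≡ + a) A)
x ∈ℤ? A = any? (λ a → x ℤ.≟ (+ a)) A

-- The size of A ∩ (A + c), i.e. the number of a ∈ A with a + c ∈ A  (A duplicate-free).
-- (Note: A ∩ (A+c) has the same size as the set of a in A with a + c in A.)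
shiftOverlap : List ℕ → ℤ → ℕ
shiftOverlap A c = length (filter (λ a → ((+ a) ℤ.+ c) ∈ℤ? A) A)

IsThinSidon : ℕ → List ℕ → Set
IsThinSidon t A = ∀ (c : ℤ) → c ≢ + 0 → shiftOverlap A c ≤ t

SubsetOfInterval : ℕ → List ℕ → Set
SubsetOfInterval n A = Unique A × All (λ a → 1 ≤ a × a ≤ n) A

ℕtoℚ : ℕ → ℚ
ℕtoℚ m = (+ m) / 1

-- s < √N + N^{1/4} + 1/2 (as real numbers), expressed via rational lower
-- bounds: there are rationals 0 ≤ a ≤ √N and 0 ≤ b ≤ N^{1/4}
-- (i.e. a² ≤ N, b⁴ ≤ N) with s < a + b + 1/2.
LtSqrtBound : ℕ → ℕ → Set
LtSqrtBound N s =
  ∃[ a ] ∃[ b ] (0ℚ ℚ.≤ a × 0ℚ ℚ.≤ b × a ℚ.* a ℚ.≤ ℕtoℚ N ×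
                 b ℚ.* b ℚ.* b ℚ.* b ℚ.≤ ℕtoℚ N ×
                 ℕtoℚ s ℚ.< a ℚ.+ b ℚ.+ ½)

-- Counting the elements of A in the n + m windows {s, …, s + m} and applying Cauchy–Schwarz,
-- t-thinness gives (m + 1) k² ≤ (n + m) (k + m t) for every m, where k = |A|.  Taking
-- m ≈ (k² − tn − k) / 2t shows that some g ≥ k² + k − tn satisfies g² + k² ≤ 4k³, i.e.
-- g ≤ k √(4k − 1).  This is what k < √(tn) + (tn)^{1/4} + 1/2 amounts to: with p / q a rational
-- approximation of √(4k − 1) from above, b = (p − q) / 2q has b² + b + 1/2 = (p² + q²) / 4q² > k,
-- and b⁴ ≤ tn, so b and a = b² are the required rational lower bounds for (tn)^{1/4} and √(tn).
module Submission where

open import Defs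
open import Data.Nat using (ℕ; _≤_; _*_)
open import Data.List using (List; length)

open import Data.Nat using (zero; suc; _+_; _∸_; _<_; z≤n; s≤s; _/_; _%_)
import Data.Nat.Properties as ℕ
open import Data.Nat.DivMod using (m≡m%n+[m/n]*n; m%n<n)
open import Data.Nat.ListAction using (sum)
open import Data.Nat.Tactic.RingSolver using (solve-∀)
import Data.Integer as ℤ
import Data.Integer.Properties as ℤ
import Data.Rational as ℚ
import Data.Rational.Properties as ℚ
open import Data.Rational.Unnormalised as ℚᵘ using (ℚᵘ; mkℚᵘ; *≤*; *<*)
import Data.Rational.Unnormalised.Properties as ℚᵘ
open import Data.Bool using (true; false; if_then_else_)
open import Data.Empty using (⊥-elim)
open import Data.List using ([]; _∷_; [_]; map; filter)
open import Data.List.Membership.Propositional using (_∈_; _∉_)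
open import Data.List.Membership.DecPropositional ℕ._≟_ using (_∈?_)
open import Data.List.Relation.Unary.All as All using (All; _∷_)
import Data.List.Relation.Unary.Any as Any
open import Data.List.Relation.Unary.Any using (here; there)
open import Data.List.Relation.Unary.AllPairs using (_∷_)
open import Data.List.Relation.Unary.Unique.Propositional using (Unique)
open import Data.Product using (Σ; _×_; _,_; proj₁; proj₂; ∃₂; ∃-syntax)
open import Data.Sum using (_⊎_; inj₁; inj₂)
open import Function using (_∘_)
open import Relation.Binary using (tri<; tri≈; tri>)
open import Relation.Binary.PropositionalEquality hiding ([_])
open import Relation.Nullary using (Dec; yes; no; does)
open import Relation.Nullary.Decidable using (dec-true; dec-false)

∑< : ℕ → (ℕ → ℕ) → ℕ
∑< zero    f = 0
∑< (suc L) f = ∑< L f + f L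

syntax ∑< L (λ i → e) = ∑[ i < L ] e

∑-cong : ∀ L {f g : ℕ → ℕ} → (∀ i → i < L → f i ≡ g i) → ∑< L f ≡ ∑< L g
∑-cong zero    f≡g = refl
∑-cong (suc L) f≡g = cong₂ _+_ (∑-cong L (λ i i<L → f≡g i (ℕ.m≤n⇒m≤1+n i<L))) (f≡g L ℕ.≤-refl)

∑-mono-≤ : ∀ L {f g : ℕ → ℕ} → (∀ i → i < L → f i ≤ g i) → ∑< L f ≤ ∑< L g
∑-mono-≤ zero    f≤g = z≤n
∑-mono-≤ (suc L) f≤g = ℕ.+-mono-≤ (∑-mono-≤ L (λ i i<L → f≤g i (ℕ.m≤n⇒m≤1+n i<L))) (f≤g L ℕ.≤-refl)

∑-distrib-+ : ∀ L (f g : ℕ → ℕ) → ∑[ i < L ] (f i + g i) ≡ ∑< L f + ∑< L g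
∑-distrib-+ zero    f g = refl
∑-distrib-+ (suc L) f g =
  trans (cong (_+ (f L + g L)) (∑-distrib-+ L f g)) (interchange (∑< L f) (∑< L g) (f L) (g L))
  where
  interchange : ∀ a b c d → a + b + (c + d) ≡ a + c + (b + d)
  interchange = solve-∀

*-distribˡ-∑ : ∀ L c (f : ℕ → ℕ) → ∑[ i < L ] (c * f i) ≡ c * ∑< L f
*-distribˡ-∑ zero    c f = sym (ℕ.*-zeroʳ c)
*-distribˡ-∑ (suc L) c f =
  trans (cong (_+ c * f L) (*-distribˡ-∑ L c f)) (sym (ℕ.*-distribˡ-+ c (∑< L f) (f L)))

*-distribʳ-∑ : ∀ L c (f : ℕ → ℕ) → ∑[ i < L ] (f i * c) ≡ ∑< L f * c
*-distribʳ-∑ zero    c f = refl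
*-distribʳ-∑ (suc L) c f =
  trans (cong (_+ f L * c) (*-distribʳ-∑ L c f)) (sym (ℕ.*-distribʳ-+ c (∑< L f) (f L)))

∑-const : ∀ L c → ∑[ i < L ] c ≡ L * c
∑-const zero    c = refl
∑-const (suc L) c = trans (cong (_+ c) (∑-const L c)) (ℕ.+-comm (L * c) c)

∑-zero : ∀ L (f : ℕ → ℕ) → (∀ i → i < L → f i ≡ 0) → ∑< L f ≡ 0
∑-zero L f f≡0 = trans (∑-cong L f≡0) (trans (∑-const L 0) (ℕ.*-zeroʳ L))

∑-comm : ∀ L M (f : ℕ → ℕ → ℕ) → ∑[ i < L ] ∑[ j < M ] f i j ≡ ∑[ j < M ] ∑[ i < L ] f i j
∑-comm zero    M f = sym (∑-zero M (λ _ → 0) (λ _ _ → refl))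
∑-comm (suc L) M f =
  trans (cong (_+ ∑[ j < M ] f L j) (∑-comm L M f)) (sym (∑-distrib-+ M (λ j → ∑[ i < L ] f i j) (f L)))

∑-split : ∀ j L (f : ℕ → ℕ) → ∑< (j + L) f ≡ ∑< j f + ∑[ s < L ] f (j + s)
∑-split j zero    f = trans (cong (λ n → ∑< n f) (ℕ.+-identityʳ j)) (sym (ℕ.+-identityʳ _))
∑-split j (suc L) f = begin
  ∑< (j + suc L) f                                   ≡⟨ cong (λ n → ∑< n f) (ℕ.+-suc j L) ⟩
  ∑< (j + L) f + f (j + L)                           ≡⟨ cong (_+ f (j + L)) (∑-split j L f) ⟩
  ∑< j f + ∑[ s < L ] f (j + s) + f (j + L)          ≡⟨ ℕ.+-assoc (∑< j f) _ _ ⟩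
  ∑< j f + ∑[ s < suc L ] f (j + s) ∎
  where open ≡-Reasoning

∑-translate : ∀ m L (g : ℕ → ℕ) j → j ≤ m → (∀ w → w < m → g w ≡ 0) → (∀ w → L ≤ w → g w ≡ 0) →
  ∑[ s < L ] g (s + j) ≡ ∑< L g
∑-translate m L g j j≤m g-below g-above = begin
  ∑[ s < L ] g (s + j)                    ≡⟨ ∑-cong L (λ s _ → cong g (ℕ.+-comm s j)) ⟩
  ∑[ s < L ] g (j + s)                    ≡⟨ cong (_+ ∑[ s < L ] g (j + s)) (sym (∑-zero j g below-j)) ⟩
  ∑< j g + ∑[ s < L ] g (j + s)           ≡⟨ sym (∑-split j L g) ⟩
  ∑< (j + L) g                            ≡⟨ cong (λ n → ∑< n g) (ℕ.+-comm j L) ⟩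
  ∑< (L + j) g                            ≡⟨ ∑-split L j g ⟩
  ∑< L g + ∑[ s < j ] g (L + s)           ≡⟨ cong (∑< L g +_) (∑-zero j _ (λ i _ → g-above _ (ℕ.m≤m+n L i))) ⟩
  ∑< L g + 0                              ≡⟨ ℕ.+-identityʳ _ ⟩
  ∑< L g ∎
  where
  open ≡-Reasoning
  below-j : ∀ i → i < j → g i ≡ 0
  below-j i i<j = g-below i (ℕ.<-≤-trans i<j j≤m)

∑-dominant-term : ∀ m (g : ℕ → ℕ) i K t → i ≤ m → g i ≡ K → (∀ j → j ≤ m → j ≢ i → g j ≤ t) →
  ∑< (suc m) g ≤ K + m * t
∑-dominant-term zero    g .zero K t z≤n gi≡K _ = ℕ.≤-reflexive (trans gi≡K (sym (ℕ.+-identityʳ K)))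
∑-dominant-term (suc m) g i K t i≤1+m gi≡K others≤t with i ℕ.≟ suc m
... | yes refl = begin
  ∑< (suc m) g + g (suc m)     ≤⟨ ℕ.+-monoˡ-≤ (g (suc m))
                                    (∑-mono-≤ (suc m) (λ j j<1+m → others≤t j (ℕ.<⇒≤ j<1+m) (ℕ.<⇒≢ j<1+m))) ⟩
  ∑[ _ < suc m ] t + g (suc m) ≡⟨ cong₂ _+_ (∑-const (suc m) t) gi≡K ⟩
  suc m * t + K                ≡⟨ ℕ.+-comm _ K ⟩
  K + suc m * t ∎
  where open ℕ.≤-Reasoning
... | no i≢1+m = begin
  ∑< (suc m) g + g (suc m)   ≤⟨ ℕ.+-mono-≤ (∑-dominant-term m g i K t i≤m gi≡K (λ j → others≤t j ∘ ℕ.m≤n⇒m≤1+n))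
                                           (others≤t (suc m) ℕ.≤-refl (i≢1+m ∘ sym)) ⟩
  K + m * t + t              ≡⟨ ℕ.+-assoc K (m * t) t ⟩
  K + (m * t + t)            ≡⟨ cong (K +_) (ℕ.+-comm (m * t) t) ⟩
  K + suc m * t ∎
  where
  open ℕ.≤-Reasoning
  i≤m : i ≤ m
  i≤m = ℕ.≤-pred (ℕ.≤∧≢⇒< i≤1+m i≢1+m)

2ab≤a²+b² : ∀ a b → 2 * (a * b) ≤ a * a + b * b
2ab≤a²+b² a b with ℕ.≤-total a b
... | inj₁ a≤b = subst (λ b → 2 * (a * b) ≤ a * a + b * b) (ℕ.m+[n∸m]≡n a≤b)
                     (ℕ.≤-trans (ℕ.m≤m+n _ _) (ℕ.≤-reflexive (square-gap a (b ∸ a))))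
  where
  square-gap : ∀ a d → 2 * (a * (a + d)) + d * d ≡ a * a + (a + d) * (a + d)
  square-gap = solve-∀
... | inj₂ b≤a = subst (λ a → 2 * (a * b) ≤ a * a + b * b) (ℕ.m+[n∸m]≡n b≤a)
                     (ℕ.≤-trans (ℕ.m≤m+n _ _) (ℕ.≤-reflexive (square-gap b (a ∸ b))))
  where
  square-gap : ∀ b d → 2 * ((b + d) * b) + d * d ≡ (b + d) * (b + d) + b * b
  square-gap = solve-∀

-- Multiply by L, apply 2ab ≤ a² + b² to a = S and b = L y, and cancel L.
cauchy-schwarz-step : ∀ L S Q y → S * S ≤ L * Q → 2 * (S * y) ≤ Q + L * (y * y)
cauchy-schwarz-step zero    zero    Q y _  = z≤n
cauchy-schwarz-step zero    (suc S) Q y ()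
cauchy-schwarz-step (suc L) S Q y S²≤LQ = ℕ.*-cancelˡ-≤ (suc L) (begin
  suc L * (2 * (S * y))                ≡⟨ rearrange (suc L) S y ⟩
  2 * (S * (suc L * y))                ≤⟨ 2ab≤a²+b² S (suc L * y) ⟩
  S * S + suc L * y * (suc L * y)      ≤⟨ ℕ.+-monoˡ-≤ _ S²≤LQ ⟩
  suc L * Q + suc L * y * (suc L * y)  ≡⟨ factor (suc L) Q y ⟩
  suc L * (Q + suc L * (y * y)) ∎)
  where
  open ℕ.≤-Reasoning
  rearrange : ∀ L S y → L * (2 * (S * y)) ≡ 2 * (S * (L * y))
  rearrange = solve-∀
  factor : ∀ L Q y → L * Q + L * y * (L * y) ≡ L * (Q + L * (y * y))
  factor = solve-∀

cauchy-schwarz : ∀ L (x : ℕ → ℕ) → ∑< L x * ∑< L x ≤ L * ∑[ s < L ] (x s * x s)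
cauchy-schwarz zero    x = z≤n
cauchy-schwarz (suc L) x = begin
  (S + y) * (S + y)                    ≡⟨ expand S y ⟩
  S * S + 2 * (S * y) + y * y          ≤⟨ ℕ.+-monoˡ-≤ (y * y) (ℕ.+-mono-≤ IH (cauchy-schwarz-step L S Q y IH)) ⟩
  L * Q + (Q + L * (y * y)) + y * y    ≡⟨ collect L Q y ⟩
  suc L * (Q + y * y) ∎
  where
  open ℕ.≤-Reasoning
  S = ∑< L x
  Q = ∑[ s < L ] (x s * x s)
  y = x L
  IH = cauchy-schwarz L x
  expand : ∀ S y → (S + y) * (S + y) ≡ S * S + 2 * (S * y) + y * y
  expand = solve-∀
  collect : ∀ L Q y → L * Q + (Q + L * (y * y)) + y * y ≡ suc L * (Q + y * y)
  collect = solve-∀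

-- With x_s the number of points of φ in the window [s, s + m], ∑ x_s = (m + 1) K, while ∑ x_s² counts
-- pairs in a common window: (m + 1) K from the diagonal and at most (m + 1) m t from the rest, since
-- each offset e ≠ 0 is realised at most t times.  Cauchy–Schwarz over the L windows concludes.
module Windows (φ : ℕ → ℕ) (m L t : ℕ)
  (φ-idem : ∀ w → φ w * φ w ≡ φ w)
  (φ-below : ∀ w → w < m → φ w ≡ 0)
  (φ-above : ∀ w → L ≤ w → φ w ≡ 0)
  (φ-thin : ∀ e → 1 ≤ e → ∑[ w < L ] (φ w * φ (w + e)) ≤ t) where

  K : ℕ
  K = ∑< L φ

  x : ℕ → ℕ
  x s = ∑[ j < suc m ] φ (s + j)

  correlation : ℕ → ℕ → ℕ
  correlation i j = ∑[ s < L ] (φ (s + i) * φ (s + j))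

  ∑x≡ : ∑< L x ≡ suc m * K
  ∑x≡ = trans (∑-comm L (suc m) (λ s j → φ (s + j)))
        (trans (∑-cong (suc m) (λ j j≤m → ∑-translate m L φ j (ℕ.≤-pred j≤m) φ-below φ-above))
               (∑-const (suc m) K))

  correlation-diagonal : ∀ i → i ≤ m → correlation i i ≡ K
  correlation-diagonal i i≤m =
    trans (∑-cong L (λ s _ → φ-idem (s + i))) (∑-translate m L φ i i≤m φ-below φ-above)

  correlation-off-diagonal : ∀ i j → i < j → j ≤ m → correlation i j ≤ t
  correlation-off-diagonal i j i<j j≤m =
    subst (_≤ t) (sym (trans (∑-cong L (λ s _ → cong (λ z → φ (s + i) * φ z) (shift s)))
                             (∑-translate m L ψ i (ℕ.≤-trans (ℕ.<⇒≤ i<j) j≤m) ψ-below ψ-above)))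
          (φ-thin (j ∸ i) (ℕ.m<n⇒0<n∸m i<j))
    where
    ψ : ℕ → ℕ
    ψ w = φ w * φ (w + (j ∸ i))
    shift : ∀ s → s + j ≡ s + i + (j ∸ i)
    shift s = sym (trans (ℕ.+-assoc s i (j ∸ i)) (cong (s +_) (ℕ.m+[n∸m]≡n (ℕ.<⇒≤ i<j))))
    ψ-below : ∀ w → w < m → ψ w ≡ 0
    ψ-below w w<m = cong (_* φ (w + (j ∸ i))) (φ-below w w<m)
    ψ-above : ∀ w → L ≤ w → ψ w ≡ 0
    ψ-above w L≤w = cong (_* φ (w + (j ∸ i))) (φ-above w L≤w)

  correlation-≢ : ∀ i j → i ≤ m → j ≤ m → j ≢ i → correlation i j ≤ t
  correlation-≢ i j i≤m j≤m j≢i with ℕ.<-cmp i j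
  ... | tri< i<j _ _ = correlation-off-diagonal i j i<j j≤m
  ... | tri≈ _ i≡j _ = ⊥-elim (j≢i (sym i≡j))
  ... | tri> _ _ j<i = subst (_≤ t) (∑-cong L (λ s _ → ℕ.*-comm (φ (s + j)) (φ (s + i))))
                             (correlation-off-diagonal j i j<i i≤m)

  ∑x²≡ : ∑[ s < L ] (x s * x s) ≡ ∑[ i < suc m ] ∑[ j < suc m ] correlation i j
  ∑x²≡ = begin
    ∑[ s < L ] (x s * x s)
      ≡⟨ ∑-cong L (λ s _ → square s) ⟩
    ∑[ s < L ] ∑[ i < suc m ] ∑[ j < suc m ] (φ (s + i) * φ (s + j))
      ≡⟨ ∑-comm L (suc m) _ ⟩
    ∑[ i < suc m ] ∑[ s < L ] ∑[ j < suc m ] (φ (s + i) * φ (s + j))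
      ≡⟨ ∑-cong (suc m) (λ i _ → ∑-comm L (suc m) _) ⟩
    ∑[ i < suc m ] ∑[ j < suc m ] correlation i j ∎
    where
    open ≡-Reasoning
    square : ∀ s → x s * x s ≡ ∑[ i < suc m ] ∑[ j < suc m ] (φ (s + i) * φ (s + j))
    square s = trans (sym (*-distribʳ-∑ (suc m) (x s) (λ i → φ (s + i))))
                     (∑-cong (suc m) (λ i _ → sym (*-distribˡ-∑ (suc m) (φ (s + i)) (λ j → φ (s + j)))))

  ∑x²≤ : ∑[ s < L ] (x s * x s) ≤ suc m * (K + m * t)
  ∑x²≤ = begin
    ∑[ s < L ] (x s * x s)                          ≡⟨ ∑x²≡ ⟩
    ∑[ i < suc m ] ∑[ j < suc m ] correlation i j   ≤⟨ ∑-mono-≤ (suc m) row-bound ⟩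
    ∑[ _ < suc m ] (K + m * t)                      ≡⟨ ∑-const (suc m) _ ⟩
    suc m * (K + m * t) ∎
    where
    open ℕ.≤-Reasoning
    row-bound : ∀ i → i < suc m → ∑[ j < suc m ] correlation i j ≤ K + m * t
    row-bound i i<1+m = ∑-dominant-term m (correlation i) i K t (ℕ.≤-pred i<1+m)
      (correlation-diagonal i (ℕ.≤-pred i<1+m)) (λ j j≤m → correlation-≢ i j (ℕ.≤-pred i<1+m) j≤m)

  window-inequality : suc m * (K * K) ≤ L * (K + m * t)
  window-inequality = ℕ.*-cancelˡ-≤ (suc m) (begin
    suc m * (suc m * (K * K))   ≡⟨ rearrange (suc m) K ⟩
    (suc m * K) * (suc m * K)   ≡⟨ cong (λ z → z * z) (sym ∑x≡) ⟩
    ∑< L x * ∑< L x             ≤⟨ cauchy-schwarz L x ⟩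
    L * ∑[ s < L ] (x s * x s)  ≤⟨ ℕ.*-monoʳ-≤ L ∑x²≤ ⟩
    L * (suc m * (K + m * t))   ≡⟨ swap L (suc m) _ ⟩
    suc m * (L * (K + m * t)) ∎)
    where
    open ℕ.≤-Reasoning
    rearrange : ∀ m K → m * (m * (K * K)) ≡ (m * K) * (m * K)
    rearrange = solve-∀
    swap : ∀ L m Z → L * (m * Z) ≡ m * (L * Z)
    swap = solve-∀

indicator : List ℕ → ℕ → ℕ
indicator A v = if does (v ∈? A) then 1 else 0

indicator-∈ : ∀ A {v} → v ∈ A → indicator A v ≡ 1
indicator-∈ A {v} v∈A rewrite dec-true (v ∈? A) v∈A = refl

indicator-∉ : ∀ A {v} → v ∉ A → indicator A v ≡ 0
indicator-∉ A {v} v∉A rewrite dec-false (v ∈? A) v∉A = refl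

indicator-idem : ∀ A v → indicator A v * indicator A v ≡ indicator A v
indicator-idem A v with does (v ∈? A)
... | true  = refl
... | false = refl

indicator-∷ : ∀ {x xs} v → x ∉ xs → indicator (x ∷ xs) v ≡ indicator [ x ] v + indicator xs v
indicator-∷ {x} {xs} v x∉xs with v ℕ.≟ x
... | yes refl = trans (indicator-∈ (x ∷ xs) (here refl))
                       (sym (cong₂ _+_ (indicator-∈ [ x ] (here refl)) (indicator-∉ xs x∉xs)))
... | no v≢x = by-membership (v ∈? xs)
  where
  v∉[x] : v ∉ [ x ]
  v∉[x] (here v≡x) = v≢x v≡x
  by-membership : Dec (v ∈ xs) → indicator (x ∷ xs) v ≡ indicator [ x ] v + indicator xs v
  by-membership (yes v∈xs) = trans (indicator-∈ (x ∷ xs) (there v∈xs))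
                                   (sym (cong₂ _+_ (indicator-∉ [ x ] v∉[x]) (indicator-∈ xs v∈xs)))
  by-membership (no v∉xs)  = trans (indicator-∉ (x ∷ xs) v∉x∷xs)
                                   (sym (cong₂ _+_ (indicator-∉ [ x ] v∉[x]) (indicator-∉ xs v∉xs)))
    where
    v∉x∷xs : v ∉ x ∷ xs
    v∉x∷xs (here v≡x)   = v≢x v≡x
    v∉x∷xs (there v∈xs) = v∉xs v∈xs

∑-indicator-singleton : ∀ n x (f : ℕ → ℕ) → x < n →
  ∑[ s < n ] (indicator [ suc x ] (suc s) * f (suc s)) ≡ f (suc x)
∑-indicator-singleton (suc n) x f x<1+n with x ℕ.≟ n
... | yes refl = trans (cong₂ _+_ (∑-zero n _ (λ s s<x → cong (_* f (suc s)) (indicator-∉ [ suc x ] (s≢x s s<x))))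
                                  (cong (_* f (suc x)) (indicator-∈ [ suc x ] (here refl))))
                       (ℕ.+-identityʳ (f (suc x)))
  where
  s≢x : ∀ s → s < x → suc s ∉ [ suc x ]
  s≢x s s<x (here 1+s≡1+x) = ℕ.<⇒≢ s<x (ℕ.suc-injective 1+s≡1+x)
... | no x≢n = trans (cong₂ _+_ (∑-indicator-singleton n x f (ℕ.≤-pred (ℕ.≤∧≢⇒< x<1+n (x≢n ∘ ℕ.suc-injective))))
                                (cong (_* f (suc n)) (indicator-∉ [ suc x ] n≢x)))
                     (ℕ.+-identityʳ (f (suc x)))
  where
  n≢x : suc n ∉ [ suc x ]
  n≢x (here 1+n≡1+x) = x≢n (sym (ℕ.suc-injective 1+n≡1+x))

∑-indicator : ∀ n A (f : ℕ → ℕ) → Unique A → All (λ a → 1 ≤ a × a ≤ n) A →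
  ∑[ s < n ] (indicator A (suc s) * f (suc s)) ≡ sum (map f A)
∑-indicator n []       f _ _ = ∑-zero n _ (λ _ _ → refl)
∑-indicator n (suc x ∷ xs) f (x∉* ∷ unique) ((s≤s z≤n , x<n) ∷ inRange) = begin
  ∑[ s < n ] (indicator (suc x ∷ xs) (suc s) * f (suc s))
    ≡⟨ ∑-cong n (λ s _ → trans (cong (_* f (suc s)) (indicator-∷ (suc s) x∉xs))
                               (ℕ.*-distribʳ-+ (f (suc s)) (indicator [ suc x ] (suc s)) (indicator xs (suc s)))) ⟩
  ∑[ s < n ] (indicator [ suc x ] (suc s) * f (suc s) + indicator xs (suc s) * f (suc s))
    ≡⟨ ∑-distrib-+ n _ _ ⟩
  ∑[ s < n ] (indicator [ suc x ] (suc s) * f (suc s)) + ∑[ s < n ] (indicator xs (suc s) * f (suc s))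
    ≡⟨ cong₂ _+_ (∑-indicator-singleton n x f x<n) (∑-indicator n xs f unique inRange) ⟩
  f (suc x) + sum (map f xs) ∎
  where
  open ≡-Reasoning
  x∉xs : suc x ∉ xs
  x∉xs x∈xs = All.lookup x∉* x∈xs refl

length-filter-shifted : ∀ A B e →
  length (filter (λ a → (ℤ.+ a ℤ.+ ℤ.+ e) ∈ℤ? A) B) ≡ sum (map (λ b → indicator A (b + e)) B)
length-filter-shifted A []      e = refl
length-filter-shifted A (b ∷ B) e with (ℤ.+ (b + e)) ∈ℤ? A
... | yes b+e∈A = cong₂ _+_ (sym (indicator-∈ A (Any.map ℤ.+-injective b+e∈A))) (length-filter-shifted A B e)
... | no  b+e∉A = trans (length-filter-shifted A B e) (cong (_+ sum (map (λ b → indicator A (b + e)) B))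
                        (sym (indicator-∉ A (b+e∉A ∘ Any.map (cong (λ v → ℤ.+ v))))))

WindowBounds : ℕ → ℕ → ℕ → Set
WindowBounds t n k = ∀ m → suc m * (k * k) ≤ (n + m) * (k + m * t)

-- φ is the indicator of A + (m − 1) ⊆ [m, m + n); below m the truncated subtraction reads A at 0 ∉ A.
module ShiftedIndicator {n A} (unique : Unique A) (inRange : All (λ a → 1 ≤ a × a ≤ n) A) (m : ℕ) where

  φ : ℕ → ℕ
  φ w = indicator A (suc w ∸ m)

  outside : ∀ v → v ≡ 0 ⊎ n < v → v ∉ A
  outside _ (inj₁ refl) 0∈A = ℕ.<-irrefl refl (proj₁ (All.lookup inRange 0∈A))
  outside v (inj₂ n<v)  v∈A = ℕ.<⇒≱ n<v (proj₂ (All.lookup inRange v∈A))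

  φ-at : ∀ s → φ (m + s) ≡ indicator A (suc s)
  φ-at s = cong (indicator A) (trans (cong (_∸ m) (sym (ℕ.+-suc m s))) (ℕ.m+n∸m≡n m (suc s)))

  φ-below : ∀ w → w < m → φ w ≡ 0
  φ-below w w<m = indicator-∉ A (outside _ (inj₁ (ℕ.m≤n⇒m∸n≡0 w<m)))

  φ-above : ∀ w → m + n ≤ w → φ w ≡ 0
  φ-above w m+n≤w = indicator-∉ A (outside _ (inj₂ (subst (_≤ suc w ∸ m) (ℕ.m+n∸m≡n m (suc n))
                                      (ℕ.∸-monoˡ-≤ m (subst (_≤ suc w) (sym (ℕ.+-suc m n)) (s≤s m+n≤w))))))

  ∑φ≡length : ∑< (m + n) φ ≡ length A
  ∑φ≡length = begin
    ∑< (m + n) φ                             ≡⟨ ∑-split m n φ ⟩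
    ∑< m φ + ∑[ s < n ] φ (m + s)
      ≡⟨ cong₂ _+_ (∑-zero m φ φ-below) (∑-cong n (λ s _ → trans (φ-at s) (sym (ℕ.*-identityʳ _)))) ⟩
    ∑[ s < n ] (indicator A (suc s) * 1)     ≡⟨ ∑-indicator n A (λ _ → 1) unique inRange ⟩
    sum (map (λ _ → 1) A)                    ≡⟨ count A ⟩
    length A ∎
    where
    open ≡-Reasoning
    count : ∀ (B : List ℕ) → sum (map (λ _ → 1) B) ≡ length B
    count []      = refl
    count (_ ∷ B) = cong suc (count B)

  ∑φφ≡shiftOverlap : ∀ e → ∑[ w < m + n ] (φ w * φ (w + e)) ≡ shiftOverlap A (ℤ.+ e)
  ∑φφ≡shiftOverlap e = begin
    ∑[ w < m + n ] (φ w * φ (w + e))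
      ≡⟨ ∑-split m n _ ⟩
    ∑[ w < m ] (φ w * φ (w + e)) + ∑[ s < n ] (φ (m + s) * φ (m + s + e))
      ≡⟨ cong₂ _+_ (∑-zero m _ (λ w w<m → cong (_* φ (w + e)) (φ-below w w<m)))
                   (∑-cong n (λ s _ → cong₂ _*_ (φ-at s) (trans (cong φ (ℕ.+-assoc m s e)) (φ-at (s + e))))) ⟩
    ∑[ s < n ] (indicator A (suc s) * indicator A (suc s + e))
      ≡⟨ ∑-indicator n A (λ a → indicator A (a + e)) unique inRange ⟩
    sum (map (λ a → indicator A (a + e)) A)
      ≡⟨ sym (length-filter-shifted A A e) ⟩
    shiftOverlap A (ℤ.+ e) ∎
    where open ≡-Reasoning

windowBounds-of-thin : ∀ t n A → Unique A → All (λ a → 1 ≤ a × a ≤ n) A → IsThinSidon t A →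
  WindowBounds t n (length A)
windowBounds-of-thin t n A unique inRange thin m =
  subst₂ _≤_ (cong (λ k → suc m * (k * k)) ∑φ≡length) (cong₂ _*_ (ℕ.+-comm m n) (cong (_+ m * t) ∑φ≡length))
    (Windows.window-inequality φ m (m + n) t (λ w → indicator-idem A _) φ-below φ-above φ-thin)
  where
  open ShiftedIndicator unique inRange m
  φ-thin : ∀ e → 1 ≤ e → ∑[ w < m + n ] (φ w * φ (w + e)) ≤ t
  φ-thin e@(suc _) _ = subst (_≤ t) (sym (∑φφ≡shiftOverlap e)) (thin (ℤ.+ e) (λ ()))

remainder-square-bound : ∀ t r K → 1 ≤ t → r < 2 * t → t ≤ K → r * r + K ≤ 4 * t * K
remainder-square-bound t@(suc t₀) r K _ r<2t t≤K = begin
  r * r + K                       ≤⟨ ℕ.+-monoˡ-≤ K (ℕ.*-mono-≤ r≤2t₀+1 r≤2t₀+1) ⟩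
  (2 * t₀ + 1) * (2 * t₀ + 1) + K ≡⟨ expand t₀ K ⟩
  4 * t₀ * t + (1 + K)            ≤⟨ ℕ.+-mono-≤ (ℕ.*-monoʳ-≤ (4 * t₀) t≤K) (ℕ.+-monoˡ-≤ K 1≤K) ⟩
  4 * t₀ * K + (K + K)            ≤⟨ ℕ.≤-trans (ℕ.m≤m+n _ (K + K)) (ℕ.≤-reflexive (collect t₀ K)) ⟩
  4 * t * K ∎
  where
  open ℕ.≤-Reasoning
  r≤2t₀+1 : r ≤ 2 * t₀ + 1
  r≤2t₀+1 = ℕ.≤-pred (subst (suc r ≤_) (double-suc t₀) r<2t)
    where
    double-suc : ∀ t₀ → 2 * suc t₀ ≡ suc (2 * t₀ + 1)
    double-suc = solve-∀
  1≤K : 1 ≤ K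
  1≤K = ℕ.≤-trans (s≤s z≤n) t≤K
  expand : ∀ t₀ K → (2 * t₀ + 1) * (2 * t₀ + 1) + K ≡ 4 * t₀ * suc t₀ + (1 + K)
  expand = solve-∀
  collect : ∀ t₀ K → 4 * t₀ * K + (K + K) + (K + K) ≡ 4 * suc t₀ * K
  collect = solve-∀

scaled-window-bound : ∀ t n k m r → t * n + k + (2 * (m * t) + r) ≡ k * k →
  suc m * (k * k) ≤ (n + m) * (k + m * t) → m * t * (m * t) + m * t * r + t * (k * k) ≤ t * n * k
scaled-window-bound t n k m r K≡k² window-m = ℕ.+-cancelˡ-≤ (M * N + M * k + M * M) _ _ (begin
  M * N + M * k + M * M + (M * M + M * r + t * (k * k))
    ≡⟨ cong (λ K → M * N + M * k + M * M + (M * M + M * r + t * K)) (sym K≡k²) ⟩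
  M * N + M * k + M * M + (M * M + M * r + t * (N + k + (2 * M + r)))
    ≡⟨ split-left M t N k r ⟩
  (M + t) * (N + k + (2 * M + r))   ≡⟨ cong ((M + t) *_) K≡k² ⟩
  (m * t + t) * (k * k)             ≡⟨ scale m t (k * k) ⟩
  t * (suc m * (k * k))             ≤⟨ ℕ.*-monoʳ-≤ t window-m ⟩
  t * ((n + m) * (k + m * t))       ≡⟨ split-right t n m k ⟩
  M * N + M * k + M * M + N * k ∎)
  where
  open ℕ.≤-Reasoning
  N = t * n
  M = m * t
  split-left : ∀ M t N k r → M * N + M * k + M * M + (M * M + M * r + t * (N + k + (2 * M + r)))
                           ≡ (M + t) * (N + k + (2 * M + r))
  split-left = solve-∀
  scale : ∀ m t K → (m * t + t) * K ≡ t * (suc m * K)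
  scale = solve-∀
  split-right : ∀ t n m k → t * ((n + m) * (k + m * t))
                          ≡ m * t * (t * n) + m * t * k + m * t * (m * t) + t * n * k
  split-right = solve-∀

-- The window bound at m = ⌊Y / 2t⌋, where Y = k² − tn − k.
excess-bound : ∀ t n k Y → 1 ≤ t → 1 ≤ n → t * n + k + Y ≡ k * k → WindowBounds t n k →
  (Y + 2 * k) * (Y + 2 * k) + k * k ≤ 4 * (k * k * k)
excess-bound t@(suc _) n@(suc _) k Y _ _ N+k+Y≡k² window = ℕ.+-cancelʳ-≤ (4 * t * (k * k)) _ _ (begin
  (Y + 2 * k) * (Y + 2 * k) + k * k + 4 * t * (k * k)
    ≡⟨ cong (λ Y → (Y + 2 * k) * (Y + 2 * k) + k * k + 4 * t * (k * k)) Y≡2M+r ⟩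
  (2 * M + r + 2 * k) * (2 * M + r + 2 * k) + k * k + 4 * t * (k * k)
    ≡⟨ expand M r t k ⟩
  4 * (M * M + M * r + t * (k * k)) + 4 * k * (k + (2 * M + r)) + r * r + k * k
    ≤⟨ ℕ.+-monoˡ-≤ (k * k) (ℕ.+-monoˡ-≤ (r * r) (ℕ.+-monoˡ-≤ (4 * k * (k + (2 * M + r)))
                                     (ℕ.*-monoʳ-≤ 4 (scaled-window-bound t n k m r K≡k² (window m))))) ⟩
  4 * (N * k) + 4 * k * (k + (2 * M + r)) + r * r + k * k
    ≡⟨ cong (λ z → z + r * r + k * k) collect ⟩
  4 * (k * k * k) + r * r + k * k
    ≤⟨ ℕ.≤-trans (ℕ.≤-reflexive (ℕ.+-assoc (4 * (k * k * k)) (r * r) (k * k)))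
                  (ℕ.+-monoʳ-≤ (4 * (k * k * k)) (remainder-square-bound t r (k * k) (s≤s z≤n) r<2t t≤k²)) ⟩
  4 * (k * k * k) + 4 * t * (k * k) ∎)
  where
  open ℕ.≤-Reasoning
  N = t * n
  m = Y / (2 * t)
  r = Y % (2 * t)
  M = m * t
  r<2t : r < 2 * t
  r<2t = m%n<n Y (2 * t)
  Y≡2M+r : Y ≡ 2 * M + r
  Y≡2M+r = trans (m≡m%n+[m/n]*n Y (2 * t)) (swap r m t)
    where
    swap : ∀ r m t → r + m * (2 * t) ≡ 2 * (m * t) + r
    swap = solve-∀
  K≡k² : N + k + (2 * M + r) ≡ k * k
  K≡k² = trans (cong ((N + k) +_) (sym Y≡2M+r)) N+k+Y≡k²
  t≤k² : t ≤ k * k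
  t≤k² = ℕ.≤-trans (ℕ.m≤m*n t n) (subst (N ≤_) N+k+Y≡k² (ℕ.≤-trans (ℕ.m≤m+n N k) (ℕ.m≤m+n (N + k) Y)))
  expand : ∀ M r t k → (2 * M + r + 2 * k) * (2 * M + r + 2 * k) + k * k + 4 * t * (k * k)
                     ≡ 4 * (M * M + M * r + t * (k * k)) + 4 * k * (k + (2 * M + r)) + r * r + k * k
  expand = solve-∀
  collect : 4 * (N * k) + 4 * k * (k + (2 * M + r)) ≡ 4 * (k * k * k)
  collect = trans (factor N k (2 * M + r)) (trans (cong (4 * k *_) K≡k²) (cube k))
    where
    factor : ∀ N k Y → 4 * (N * k) + 4 * k * (k + Y) ≡ 4 * k * (N + k + Y)
    factor = solve-∀
    cube : ∀ k → 4 * k * (k * k) ≡ 4 * (k * k * k)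
    cube = solve-∀

criterion-of-windowBounds : ∀ t n k → 1 ≤ t → 1 ≤ n → 2 ≤ k → WindowBounds t n k →
  ∃[ g ] k * k + k ≤ t * n + g × g * g + k * k ≤ 4 * (k * k * k)
criterion-of-windowBounds t n k 1≤t 1≤n 2≤k window with k * k ℕ.≤? t * n + k
... | yes k²≤N+k = 2 * k , ℕ.≤-trans (ℕ.+-monoˡ-≤ k k²≤N+k) (ℕ.≤-reflexive (regroup (t * n) k)) , 5k²≤4k³
  where
  regroup : ∀ N k → N + k + k ≡ N + 2 * k
  regroup = solve-∀
  5k²≤4k³ : 2 * k * (2 * k) + k * k ≤ 4 * (k * k * k)
  5k²≤4k³ = begin
    2 * k * (2 * k) + k * k   ≡⟨ five k ⟩
    5 * (k * k)               ≤⟨ ℕ.*-monoˡ-≤ (k * k) (ℕ.≤-trans (ℕ.m≤m+n 5 3) (ℕ.*-monoʳ-≤ 4 2≤k)) ⟩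
    4 * k * (k * k)           ≡⟨ cube k ⟩
    4 * (k * k * k) ∎
    where
    open ℕ.≤-Reasoning
    five : ∀ k → 2 * k * (2 * k) + k * k ≡ 5 * (k * k)
    five = solve-∀
    cube : ∀ k → 4 * k * (k * k) ≡ 4 * (k * k * k)
    cube = solve-∀
... | no k²≰N+k = Y + 2 * k , ℕ.≤-reflexive k²+k≡ , excess-bound t n k Y 1≤t 1≤n N+k+Y≡k² window
  where
  Y = k * k ∸ (t * n + k)
  N+k+Y≡k² : t * n + k + Y ≡ k * k
  N+k+Y≡k² = ℕ.m+[n∸m]≡n (ℕ.<⇒≤ (ℕ.≰⇒> k²≰N+k))
  k²+k≡ : k * k + k ≡ t * n + (Y + 2 * k)
  k²+k≡ = trans (cong (_+ k) (sym N+k+Y≡k²)) (regroup (t * n) k Y)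
    where
    regroup : ∀ N k Y → N + k + Y + k ≡ N + (Y + 2 * k)
    regroup = solve-∀

square-cancel-< : ∀ {m n} → m * m < n * n → m < n
square-cancel-< m²<n² = ℕ.≰⇒> (λ n≤m → ℕ.<⇒≱ m²<n² (ℕ.*-mono-≤ n≤m n≤m))

square-cancel-≤ : ∀ {m n} → m * m ≤ n * n → m ≤ n
square-cancel-≤ m²≤n² = ℕ.≮⇒≥ (λ n<m → ℕ.<⇒≱ (ℕ.*-mono-< n<m n<m) m²≤n²)

floor-inverse : (f : ℕ → ℕ) → (∀ s → f s < f (suc s)) →
  ∀ X → f 0 ≤ X → ∃[ s ] f s ≤ X × X < f (suc s)
floor-inverse f f↑ zero f0≤0 = 0 , f0≤0 , ℕ.≤-<-trans z≤n (f↑ 0)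
floor-inverse f f↑ (suc X) f0≤1+X with f 0 ℕ.≤? X
... | no f0≰X = 0 , f0≤1+X , subst (_< f 1) (ℕ.≤-antisym f0≤1+X (ℕ.≰⇒> f0≰X)) (f↑ 0)
... | yes f0≤X with floor-inverse f f↑ X f0≤X
...   | s , fs≤X , X<fs' with suc X ℕ.<? f (suc s)
...     | yes 1+X<fs' = s , ℕ.m≤n⇒m≤1+n fs≤X , 1+X<fs'
...     | no 1+X≮fs' =
  suc s , ℕ.≮⇒≥ 1+X≮fs' , subst (_< f (suc (suc s))) (ℕ.≤-antisym (ℕ.≮⇒≥ 1+X≮fs') X<fs') (f↑ (suc s))

overshoot-bound : ∀ k q s → 1 ≤ k → 16 * (k * k) ≤ q → s * s + q * q ≤ 4 * k * (q * q) →
  4 * k * (suc s * suc s + q * q ∸ 4 * k * (q * q)) ≤ q * q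
overshoot-bound k q s 1≤k 16k²≤q s²+q²≤X = begin
  4 * k * ε                 ≤⟨ ℕ.*-monoʳ-≤ (4 * k) ε≤2s+1 ⟩
  4 * k * (2 * s + 1)       ≤⟨ ℕ.*-monoʳ-≤ (4 * k) 2s+1≤4kq ⟩
  4 * k * (2 * (2 * k * q)) ≡⟨ rearrange k q ⟩
  16 * (k * k) * q          ≤⟨ ℕ.*-monoˡ-≤ q 16k²≤q ⟩
  q * q ∎
  where
  open ℕ.≤-Reasoning
  X = 4 * k * (q * q)
  ε = suc s * suc s + q * q ∸ X
  consecutive : ∀ s q → s * s + q * q + (2 * s + 1) ≡ suc s * suc s + q * q
  consecutive = solve-∀
  ε≤2s+1 : ε ≤ 2 * s + 1
  ε≤2s+1 = begin
    suc s * suc s + q * q ∸ X                     ≤⟨ ℕ.∸-monoʳ-≤ _ s²+q²≤X ⟩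
    suc s * suc s + q * q ∸ (s * s + q * q)       ≡⟨ cong (_∸ (s * s + q * q)) (sym (consecutive s q)) ⟩
    s * s + q * q + (2 * s + 1) ∸ (s * s + q * q) ≡⟨ ℕ.m+n∸m≡n (s * s + q * q) _ ⟩
    2 * s + 1 ∎
  1≤q : 1 ≤ q
  1≤q = ℕ.≤-trans (ℕ.*-mono-≤ {1} {16} (s≤s z≤n) (ℕ.*-mono-≤ 1≤k 1≤k)) 16k²≤q
  k≤k² : k ≤ k * k
  k≤k² = ℕ.≤-trans (ℕ.≤-reflexive (sym (ℕ.*-identityʳ k))) (ℕ.*-monoʳ-≤ k 1≤k)
  square-2kq : ∀ k q → 4 * (k * k) * (q * q) ≡ 2 * k * q * (2 * k * q)
  square-2kq = solve-∀
  s<2kq : s < 2 * k * q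
  s<2kq = square-cancel-< (begin-strict
    s * s                   <⟨ ℕ.m<m+n (s * s) (ℕ.*-mono-≤ 1≤q 1≤q) ⟩
    s * s + q * q           ≤⟨ s²+q²≤X ⟩
    4 * k * (q * q)         ≤⟨ ℕ.*-monoˡ-≤ (q * q) (ℕ.*-monoʳ-≤ 4 k≤k²) ⟩
    4 * (k * k) * (q * q)   ≡⟨ square-2kq k q ⟩
    2 * k * q * (2 * k * q) ∎)
  double-suc : ∀ s → 2 * suc s ≡ suc (2 * s + 1)
  double-suc = solve-∀
  2s+1≤4kq : 2 * s + 1 ≤ 2 * (2 * k * q)
  2s+1≤4kq = ℕ.≤-trans (ℕ.n≤1+n (2 * s + 1)) (subst (_≤ 2 * (2 * k * q)) (double-suc s) (ℕ.*-monoʳ-≤ 2 s<2kq))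
  rearrange : ∀ k q → 4 * k * (2 * (2 * k * q)) ≡ 16 * (k * k) * q
  rearrange = solve-∀

-- (q + d) / q approximates √(4k − 1) from above with error ε / q² ∈ (0, 1/(4k)].
root-approximation : ∀ k q → 1 ≤ k → 16 * (k * k) ≤ q →
  ∃₂ λ d ε → 4 * k * (q * q) + ε ≡ (q + d) * (q + d) + q * q × 1 ≤ ε × 4 * k * ε ≤ q * q
root-approximation k q 1≤k 16k²≤q
  with floor-inverse (λ s → s * s + q * q) (λ s → ℕ.+-monoˡ-< (q * q) (ℕ.*-mono-< (ℕ.n<1+n s) (ℕ.n<1+n s)))
                     (4 * k * (q * q))
                     (ℕ.≤-trans (ℕ.≤-reflexive (sym (ℕ.*-identityˡ (q * q))))
                                (ℕ.*-monoˡ-≤ (q * q) (ℕ.*-mono-≤ {1} {4} (s≤s z≤n) 1≤k)))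
... | s , s²+q²≤X , X<p²+q² =
  p ∸ q , ε , subst (λ p → X + ε ≡ p * p + q * q) (sym (ℕ.m+[n∸m]≡n q≤p)) (ℕ.m+[n∸m]≡n (ℕ.<⇒≤ X<p²+q²)) ,
  ℕ.m<n⇒0<n∸m X<p²+q² , overshoot-bound k q s 1≤k 16k²≤q s²+q²≤X
  where
  X = 4 * k * (q * q)
  p = suc s
  ε = p * p + q * q ∸ X
  q≤p : q ≤ p
  q≤p = square-cancel-≤ (ℕ.<⇒≤ (ℕ.+-cancelʳ-< (q * q) (q * q) (p * p) (ℕ.≤-<-trans 2q²≤X X<p²+q²)))
    where
    2q²≤X : q * q + q * q ≤ X
    2q²≤X = ℕ.≤-trans (ℕ.≤-reflexive (double (q * q))) (ℕ.*-monoˡ-≤ (q * q) (ℕ.*-mono-≤ {2} {4} (ℕ.m≤m+n 2 2) 1≤k))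
      where
      double : ∀ x → x + x ≡ 2 * 1 * x
      double = solve-∀

-- With X = (q + d)² + q² one has d⁴ + 4q(q + d)X + 4q⁴ = X² + 4q²X; substituting X = 4kq² + ε
-- leaves an error term in ε that the slack 4q(q + d)ε + 4q⁴ absorbs.
quartic-bound : ∀ k g q d ε → 1 ≤ k →
  4 * k * (q * q) + ε ≡ (q + d) * (q + d) + q * q → 4 * k * ε ≤ q * q → g * q ≤ k * (q + d) →
  d * d * (d * d) + 16 * g * (q * q * (q * q)) ≤ 16 * (k * k + k) * (q * q * (q * q))
quartic-bound k@(suc _) g q d ε _ X≡ 4kε≤q² gq≤k[q+d] = ℕ.+-cancelʳ-≤ slack _ _ (begin
  d⁴ + 16 * g * q⁴ + slack                          ≡⟨ cong (λ z → d⁴ + z + slack) (split-q⁴ g q) ⟩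
  d⁴ + 16 * (q * q * q) * (g * q) + slack
    ≤⟨ ℕ.+-monoˡ-≤ slack (ℕ.+-monoʳ-≤ d⁴ (ℕ.*-monoʳ-≤ (16 * (q * q * q)) gq≤k[q+d])) ⟩
  d⁴ + 16 * (q * q * q) * (k * (q + d)) + slack     ≡⟨ expand k q d ε ⟩
  d⁴ + 4 * q * (q + d) * (4 * k * (q * q) + ε) + 4 * q⁴ ≡⟨ cong (λ X → d⁴ + 4 * q * (q + d) * X + 4 * q⁴) X≡ ⟩
  d⁴ + 4 * q * (q + d) * X + 4 * q⁴                 ≡⟨ fourth-power-identity q d ⟩
  X * X + 4 * (q * q) * X                           ≡⟨ cong (λ X → X * X + 4 * (q * q) * X) (sym X≡) ⟩
  (4 * k * (q * q) + ε) * (4 * k * (q * q) + ε) + 4 * (q * q) * (4 * k * (q * q) + ε) ≡⟨ collect k q ε ⟩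
  16 * (k * k + k) * q⁴ + error                     ≤⟨ ℕ.+-monoʳ-≤ (16 * (k * k + k) * q⁴) error≤slack ⟩
  16 * (k * k + k) * q⁴ + slack ∎)
  where
  open ℕ.≤-Reasoning
  d⁴ = d * d * (d * d)
  q⁴ = q * q * (q * q)
  X = (q + d) * (q + d) + q * q
  slack = 4 * q * (q + d) * ε + 4 * q⁴
  error = 2 * (q * q) * (4 * k * ε) + ε * ε + 4 * q * q * ε
  split-q⁴ : ∀ g q → 16 * g * (q * q * (q * q)) ≡ 16 * (q * q * q) * (g * q)
  split-q⁴ = solve-∀
  expand : ∀ k q d ε → let q⁴ = q * q * (q * q) in
    d * d * (d * d) + 16 * (q * q * q) * (k * (q + d)) + (4 * q * (q + d) * ε + 4 * q⁴)
    ≡ d * d * (d * d) + 4 * q * (q + d) * (4 * k * (q * q) + ε) + 4 * q⁴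
  expand = solve-∀
  fourth-power-identity : ∀ q d → let X = (q + d) * (q + d) + q * q in
    d * d * (d * d) + 4 * q * (q + d) * X + 4 * (q * q * (q * q)) ≡ X * X + 4 * (q * q) * X
  fourth-power-identity = solve-∀
  collect : ∀ k q ε → let Y = 4 * k * (q * q) + ε in
    Y * Y + 4 * (q * q) * Y
    ≡ 16 * (k * k + k) * (q * q * (q * q)) + (2 * (q * q) * (4 * k * ε) + ε * ε + 4 * q * q * ε)
  collect = solve-∀
  ε≤q² : ε ≤ q * q
  ε≤q² = ℕ.≤-trans (ℕ.m≤n*m ε (4 * k)) 4kε≤q²
  absorb : ∀ q y → 2 * (q * q) * (q * q) + q * q * (q * q) + y ≡ y + 3 * (q * q * (q * q))
  absorb = solve-∀
  error≤slack : error ≤ slack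
  error≤slack = begin
    error
      ≤⟨ ℕ.+-mono-≤ (ℕ.+-mono-≤ (ℕ.*-monoʳ-≤ (2 * (q * q)) 4kε≤q²) (ℕ.*-mono-≤ ε≤q² ε≤q²))
                    (ℕ.*-monoˡ-≤ ε (ℕ.*-monoʳ-≤ (4 * q) (ℕ.m≤m+n q d))) ⟩
    2 * (q * q) * (q * q) + q⁴ + 4 * q * (q + d) * ε ≡⟨ absorb q _ ⟩
    4 * q * (q + d) * ε + 3 * q⁴          ≤⟨ ℕ.+-monoʳ-≤ (4 * q * (q + d) * ε) (ℕ.*-monoˡ-≤ q⁴ (ℕ.n≤1+n 3)) ⟩
    slack ∎

-- toℚᵘ x is ≃ to a representative with numerator a and denominator d, so that the order of ℚ
-- reduces to cross-multiplication in ℕ.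
infix 4 _≐_÷_
_≐_÷_ : ℚ.ℚ → ℕ → ℕ → Set
x ≐ a ÷ d = Σ ℚᵘ λ p → ℚ.toℚᵘ x ℚᵘ.≃ p × ℚᵘ.↥ p ≡ ℤ.+ a × ℚᵘ.↧ₙ p ≡ d

≐-fraction : ∀ a d → ℚ.fromℚᵘ (mkℚᵘ (ℤ.+ a) d) ≐ a ÷ suc d
≐-fraction a d = mkℚᵘ (ℤ.+ a) d , ℚ.toℚᵘ-fromℚᵘ _ , refl , refl

≐-* : ∀ {x y a b d e} → x ≐ a ÷ d → y ≐ b ÷ e → x ℚ.* y ≐ a * b ÷ (d * e)
≐-* {x} {y} {a} {b} (mkℚᵘ _ _ , x≃ , refl , refl) (mkℚᵘ _ _ , y≃ , refl , refl) =
  _ , ℚᵘ.≃-trans (ℚ.toℚᵘ-homo-* x y) (ℚᵘ.*-cong x≃ y≃) , sym (ℤ.pos-* a b) , refl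

≐-+ : ∀ {x y a b d e} → x ≐ a ÷ d → y ≐ b ÷ e → x ℚ.+ y ≐ a * e + b * d ÷ (d * e)
≐-+ {x} {y} {a} {b} {d} {e} (mkℚᵘ _ _ , x≃ , refl , refl) (mkℚᵘ _ _ , y≃ , refl , refl) =
  _ , ℚᵘ.≃-trans (ℚ.toℚᵘ-homo-+ x y) (ℚᵘ.+-cong x≃ y≃) ,
  cong₂ ℤ._+_ (sym (ℤ.pos-* a e)) (sym (ℤ.pos-* b d)) , refl

≐-≤ : ∀ {x y a b d e} → x ≐ a ÷ d → y ≐ b ÷ e → a * e ≤ b * d → x ℚ.≤ y
≐-≤ {a = a} {b} {d} {e} (p@(mkℚᵘ _ _) , x≃ , refl , refl) (q@(mkℚᵘ _ _) , y≃ , refl , refl) ae≤bd =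
  ℚ.toℚᵘ-cancel-≤ (ℚᵘ.≤-respˡ-≃ (ℚᵘ.≃-sym x≃) (ℚᵘ.≤-respʳ-≃ (ℚᵘ.≃-sym y≃)
    (*≤* (subst₂ ℤ._≤_ (ℤ.pos-* a e) (ℤ.pos-* b d) (ℤ.+≤+ ae≤bd)))))

≐-< : ∀ {x y a b d e} → x ≐ a ÷ d → y ≐ b ÷ e → a * e < b * d → x ℚ.< y
≐-< {a = a} {b} {d} {e} (p@(mkℚᵘ _ _) , x≃ , refl , refl) (q@(mkℚᵘ _ _) , y≃ , refl , refl) ae<bd =
  ℚ.toℚᵘ-cancel-< (ℚᵘ.<-respˡ-≃ (ℚᵘ.≃-sym x≃) (ℚᵘ.<-respʳ-≃ (ℚᵘ.≃-sym y≃)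
    (*<* (subst₂ ℤ._<_ (ℤ.pos-* a e) (ℤ.pos-* b d) (ℤ.+<+ ae<bd)))))

ltSqrtBound-of-fraction : ∀ N k R Q → 1 ≤ Q →
  R * R * (R * R) ≤ N * (Q * Q * (Q * Q)) →
  2 * k * (Q * Q) < 2 * (R * R) + 2 * (R * Q) + Q * Q →
  LtSqrtBound N k
ltSqrtBound-of-fraction N k R (suc Q') _ R⁴≤NQ⁴ k<c²+c+½ =
  c ℚ.* c , c ,
  ≐-≤ (≐-fraction 0 0) c² z≤n ,
  ≐-≤ (≐-fraction 0 0) c≐ z≤n ,
  ≐-≤ (≐-* c² c²) (≐-fraction N 0) (subst₂ _≤_ (sym (ℕ.*-identityʳ _)) refl R⁴≤NQ⁴) ,
  ≐-≤ (≐-* (≐-* c² c≐) c≐) (≐-fraction N 0)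
      (subst₂ _≤_ (trans (quartic R) (sym (ℕ.*-identityʳ _))) (cong (N *_) (quartic Q)) R⁴≤NQ⁴) ,
  ≐-< (≐-fraction k 0) (≐-+ (≐-+ c² c≐) (≐-fraction 1 1))
      (subst₂ _<_ (lhs k Q) (rhs R Q) (ℕ.*-monoˡ-< Q k<c²+c+½))
  where
  Q = suc Q'
  c = ℚ.fromℚᵘ (mkℚᵘ (ℤ.+ R) Q')
  c≐ : c ≐ R ÷ Q
  c≐ = ≐-fraction R Q'
  c² : c ℚ.* c ≐ R * R ÷ (Q * Q)
  c² = ≐-* c≐ c≐
  quartic : ∀ x → x * x * (x * x) ≡ x * x * x * x
  quartic = solve-∀
  lhs : ∀ k Q → 2 * k * (Q * Q) * Q ≡ k * (Q * Q * Q * 2)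
  lhs = solve-∀
  rhs : ∀ R Q → (2 * (R * R) + 2 * (R * Q) + Q * Q) * Q
              ≡ ((R * R * Q + R * (Q * Q)) * 2 + 1 * (Q * Q * Q)) * 1
  rhs = solve-∀

g²+k²≤4k³⇒gq≤kp : ∀ g k q p → g * g + k * k ≤ 4 * (k * k * k) → 4 * k * (q * q) ≤ p * p + q * q →
  g * q ≤ k * p
g²+k²≤4k³⇒gq≤kp g k q p g²+k²≤4k³ X≤p²+q² =
  square-cancel-≤ (ℕ.+-cancelʳ-≤ (k * q * (k * q)) _ _ (begin
  g * q * (g * q) + k * q * (k * q)   ≡⟨ factor-q² g k q ⟩
  (g * g + k * k) * (q * q)           ≤⟨ ℕ.*-monoˡ-≤ (q * q) g²+k²≤4k³ ⟩
  4 * (k * k * k) * (q * q)           ≡⟨ factor-k² k q ⟩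
  k * k * (4 * k * (q * q))           ≤⟨ ℕ.*-monoʳ-≤ (k * k) X≤p²+q² ⟩
  k * k * (p * p + q * q)             ≡⟨ distribute k q p ⟩
  k * p * (k * p) + k * q * (k * q) ∎))
  where
  open ℕ.≤-Reasoning
  factor-q² : ∀ g k q → g * q * (g * q) + k * q * (k * q) ≡ (g * g + k * k) * (q * q)
  factor-q² = solve-∀
  factor-k² : ∀ k q → 4 * (k * k * k) * (q * q) ≡ k * k * (4 * k * (q * q))
  factor-k² = solve-∀
  distribute : ∀ k q p → k * k * (p * p + q * q) ≡ k * p * (k * p) + k * q * (k * q)
  distribute = solve-∀

-- b = d / 2q and a = b², where (q + d) / q approximates √(4k − 1) as in root-approximation.
ltSqrtBound-of-approximation : ∀ N k g q d ε → 1 ≤ k → 1 ≤ q →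
  k * k + k ≤ N + g → g * g + k * k ≤ 4 * (k * k * k) →
  4 * k * (q * q) + ε ≡ (q + d) * (q + d) + q * q → 1 ≤ ε → 4 * k * ε ≤ q * q →
  LtSqrtBound N k
ltSqrtBound-of-approximation N k g q d ε 1≤k 1≤q k²+k≤N+g g²+k²≤4k³ X≡ 1≤ε 4kε≤q² =
  ltSqrtBound-of-fraction N k d (2 * q) (ℕ.≤-trans 1≤q (ℕ.m≤m+n q _)) d⁴≤N[2q]⁴ k<b²+b+½
  where
  open ℕ.≤-Reasoning
  q⁴ = q * q * (q * q)
  gq≤k[q+d] : g * q ≤ k * (q + d)
  gq≤k[q+d] = g²+k²≤4k³⇒gq≤kp g k q (q + d) g²+k²≤4k³ (ℕ.≤-trans (ℕ.m≤m+n _ ε) (ℕ.≤-reflexive X≡))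
  d⁴≤N[2q]⁴ : d * d * (d * d) ≤ N * (2 * q * (2 * q) * (2 * q * (2 * q)))
  d⁴≤N[2q]⁴ = ℕ.+-cancelʳ-≤ (16 * g * q⁴) _ _ (begin
    d * d * (d * d) + 16 * g * q⁴  ≤⟨ quartic-bound k g q d ε 1≤k X≡ 4kε≤q² gq≤k[q+d] ⟩
    16 * (k * k + k) * q⁴          ≤⟨ ℕ.*-monoˡ-≤ q⁴ (ℕ.*-monoʳ-≤ 16 k²+k≤N+g) ⟩
    16 * (N + g) * q⁴              ≡⟨ distribute N g q ⟩
    N * (2 * q * (2 * q) * (2 * q * (2 * q))) + 16 * g * q⁴ ∎)
    where
    distribute : ∀ N g q → 16 * (N + g) * (q * q * (q * q))
                         ≡ N * (2 * q * (2 * q) * (2 * q * (2 * q))) + 16 * g * (q * q * (q * q))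
    distribute = solve-∀
  k<b²+b+½ : 2 * k * (2 * q * (2 * q)) < 2 * (d * d) + 2 * (d * (2 * q)) + 2 * q * (2 * q)
  k<b²+b+½ = begin-strict
    2 * k * (2 * q * (2 * q))                          ≡⟨ scale k q ⟩
    2 * (4 * k * (q * q))                              <⟨ ℕ.*-monoʳ-< 2 (ℕ.m<m+n (4 * k * (q * q)) 1≤ε) ⟩
    2 * (4 * k * (q * q) + ε)                          ≡⟨ cong (2 *_) X≡ ⟩
    2 * ((q + d) * (q + d) + q * q)                    ≡⟨ expand q d ⟩
    2 * (d * d) + 2 * (d * (2 * q)) + 2 * q * (2 * q) ∎
    where
    scale : ∀ k q → 2 * k * (2 * q * (2 * q)) ≡ 2 * (4 * k * (q * q))
    scale = solve-∀
    expand : ∀ q d → 2 * ((q + d) * (q + d) + q * q) ≡ 2 * (d * d) + 2 * (d * (2 * q)) + 2 * q * (2 * q)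
    expand = solve-∀

ltSqrtBound-of-criterion : ∀ N k g → 1 ≤ k → k * k + k ≤ N + g → g * g + k * k ≤ 4 * (k * k * k) →
  LtSqrtBound N k
ltSqrtBound-of-criterion N k g 1≤k k²+k≤N+g g²+k²≤4k³ =
  let d , ε , X≡ , 1≤ε , 4kε≤q² = root-approximation k q 1≤k ℕ.≤-refl
  in ltSqrtBound-of-approximation N k g q d ε 1≤k 1≤q k²+k≤N+g g²+k²≤4k³ X≡ 1≤ε 4kε≤q²
  where
  q = 16 * (k * k)
  1≤q : 1 ≤ q
  1≤q = ℕ.*-mono-≤ {1} {16} (s≤s z≤n) (ℕ.*-mono-≤ 1≤k 1≤k)

ltSqrtBound-of-windowBounds : ∀ t n k → 1 ≤ t → 1 ≤ n → WindowBounds t n k → LtSqrtBound (t * n) k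
ltSqrtBound-of-windowBounds t n k 1≤t 1≤n window with k ℕ.≤? 1
... | yes k≤1 = ltSqrtBound-of-fraction (t * n) k 1 1 ℕ.≤-refl
                  (ℕ.≤-trans (ℕ.*-mono-≤ 1≤t 1≤n) (ℕ.≤-reflexive (sym (ℕ.*-identityʳ (t * n)))))
                  (s≤s (ℕ.≤-trans (ℕ.*-monoˡ-≤ 1 (ℕ.*-monoʳ-≤ 2 k≤1)) (ℕ.m≤m+n 2 2)))
... | no k≰1 with criterion-of-windowBounds t n k 1≤t 1≤n (ℕ.≰⇒> k≰1) window
...   | g , k²+k≤N+g , g²+k²≤4k³ =
  ltSqrtBound-of-criterion (t * n) k g (ℕ.≤-trans (s≤s z≤n) (ℕ.≰⇒> k≰1)) k²+k≤N+g g²+k²≤4k³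

mainTheorem5 : ∀ (t n : ℕ) → 1 ≤ t → 1 ≤ n →
    ∀ (A : List ℕ) → SubsetOfInterval n A → IsThinSidon t A →
    LtSqrtBound (t * n) (length A)
mainTheorem5 t n 1≤t 1≤n A (unique , inRange) thin =
  ltSqrtBound-of-windowBounds t n (length A) 1≤t 1≤n (windowBounds-of-thin t n A unique inRange thin)
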